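{- Let $G=(V,E)$ be a connected graph and let $\ell: V\to\{ -1,+1\}$ be a labeling, unknown to the predictor. Let $A$ be an online routing algorithm on $G$ which, on every request sequence, guarantees that every edge of $G$ is used by at most $\alpha$ of the routed paths. Let $P_A$ be the online prediction algorithm that, on query $v_i$ with $i\ge 2$, feeds $v_i$ to $A$ as the next request, obtains from $A$ a path from $v_i$ to some earlier queried vertex $v_j$ ($j<i$), and predicts the label $\ell(v_j)$. Then, for every query sequence $v_1,v_2,\ldots$, the number of rounds $i\ge 2$ in which $P_A$ predicts incorrectly is at most $\alpha\cdot|cut(\ell)|$, where $cut(\ell)=\{(u,v)\in E:\ell(u)\neq\ell(v)\}$.
   Context: Online prediction of graph labeling: in each round $i=1,2,\ldots$ an adversary asks for the label of a vertex $v_i\in V$; the algorithm outputs a prediction $y_i$ and then learns the true label $\ell(v_i)$. A mistake is a round with $y_i\neq \ell(v_i)$; the mistake on the first query $v_1$ is not counted. Online routing problem: the algorithm receives requests $r_1,r_2,\ldots$ with $r_i\in V$, and for each $r_i$ with $i>1$ must, before seeing later requests, output a path in $G$ routing one unit of flow from $r_i$ to some earlier request $r_j$, $j<i$. The congestion of an edge is the number of output paths using it. -}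

module Defs where

open import Data.Nat using (ℕ; zero; suc; _+_; _<ᵇ_)
open import Data.Fin using (Fin; toℕ; _≟_)
open import Data.Bool using (Bool; true; false; _∧_; _∨_; not; if_then_else_)
open import Data.List using (List; []; _∷_; _++_; allFin; filter; length; concatMap)
open import Data.List.Membership.Propositional using (_∈_)
open import Data.Product using (_×_; _,_; ∃-syntax)
open import Relation.Nullary.Decidable using (⌊_⌋)
open import Relation.Binary.PropositionalEquality using (_≡_; _≢_)
open import Data.Empty using (⊥)
open import Data.Unit using (⊤)

record Graph (n : ℕ) : Set where
  field
    adj   : Fin n → Fin n → Bool
    sym   : ∀ u v → adj u v ≡ adj v u
    irref : ∀ u → adj u u ≡ false
open Graph public

-- Labels in {-1,+1} encoded as Bool.
Labeling : ℕ → Set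
Labeling n = Fin n → Bool

-- A walk starting at vertex r is the list of subsequent vertices.
IsWalk : ∀ {n} → Graph n → Fin n → List (Fin n) → Set
IsWalk G r []       = ⊤
IsWalk G r (x ∷ xs) = adj G r x ≡ true × IsWalk G x xs

endpoint : ∀ {n} → Fin n → List (Fin n) → Fin n
endpoint r []       = r
endpoint r (x ∷ xs) = endpoint x xs

Connected : ∀ {n} → Graph n → Set
Connected {n} G = ∀ (u v : Fin n) → ∃[ p ] (IsWalk G u p × endpoint u p ≡ v)

sameEdge : ∀ {n} → Fin n → Fin n → Fin n → Fin n → Bool
sameEdge a b u v = (⌊ u ≟ a ⌋ ∧ ⌊ v ≟ b ⌋) ∨ (⌊ u ≟ b ⌋ ∧ ⌊ v ≟ a ⌋)

usesEdge : ∀ {n} → Fin n → Fin n → Fin n → List (Fin n) → Bool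
usesEdge a b r []       = false
usesEdge a b r (x ∷ xs) = sameEdge a b r x ∨ usesEdge a b x xs

count : ∀ {A : Set} → (A → Bool) → List A → ℕ
count f []       = 0
count f (x ∷ xs) = (if f x then 1 else 0) + count f xs

record RoutingAlgorithm {n : ℕ} (G : Graph n) : Set where
  field
    route : List (Fin n) → Fin n → List (Fin n)
    valid : ∀ (prev : List (Fin n)) (r : Fin n) → prev ≢ [] →
            IsWalk G r (route prev r) × endpoint r (route prev r) ∈ prev
open RoutingAlgorithm public

runFrom : ∀ {n} {G : Graph n} → RoutingAlgorithm G →
          List (Fin n) → List (Fin n) → List (Fin n × List (Fin n))
runFrom A prev []       = []
runFrom A prev (r ∷ rs) = (r , route A prev r) ∷ runFrom A (prev ++ (r ∷ [])) rs

run : ∀ {n} {G : Graph n} → RoutingAlgorithm G →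
      List (Fin n) → List (Fin n × List (Fin n))
run A []       = []
run A (r ∷ rs) = runFrom A (r ∷ []) rs

congestion : ∀ {n} {G : Graph n} → RoutingAlgorithm G →
             List (Fin n) → Fin n → Fin n → ℕ
congestion A rs a b = count (λ { (r , p) → usesEdge a b r p }) (run A rs)

mistakes : ∀ {n} {G : Graph n} → RoutingAlgorithm G → Labeling n →
           List (Fin n) → ℕ
mistakes A ℓ qs =
  count (λ { (r , p) → not ⌊ Data.Bool._≟_ (ℓ (endpoint r p)) (ℓ r) ⌋ }) (run A qs)

-- |cut(ℓ)|: undirected edges {u,v} (counted once, via toℕ u < toℕ v)
-- with differently labelled endpoints.
cutSize : ∀ {n} → Graph n → Labeling n → ℕ
cutSize {n} G ℓ =
  count (λ { (u , v) → (toℕ u <ᵇ toℕ v) ∧ adj G u v ∧ not ⌊ Data.Bool._≟_ (ℓ u) (ℓ v) ⌋ })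
        (concatMap (λ u → Data.List.map (λ v → (u , v)) (allFin n)) (allFin n))

-- Charge every mistake to a cut edge: the routed walk from the query vᵢ to the
-- earlier query vⱼ whose label is predicted starts and ends at differently
-- labelled vertices, so it traverses some edge of cut(ℓ). Summing over rounds,
-- the number of mistakes is at most the total number of (walk, cut edge)
-- incidences, and each cut edge lies on at most α of the routed walks.
module Submission where

open import Defs hiding (sym)
open import Algebra.Properties.CommutativeSemigroup using (interchange)
open import Data.Bool using (Bool; true; false; _∧_; not; if_then_else_)
import Data.Bool as Bool
open import Data.Bool.Properties using (∨-zeroʳ; ∨-comm; T-≡)
open import Data.Empty using (⊥-elim)
open import Data.Fin using (Fin; toℕ)
import Data.Fin as Fin
open import Data.Fin.Properties using (toℕ-injective)
open import Data.List using (List; []; _∷_; _++_; allFin; concatMap; map)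
open import Data.List.Membership.Propositional using (_∈_; lose)
open import Data.List.Membership.Propositional.Properties using (∈-concatMap⁺; ∈-map⁺; ∈-allFin)
open import Data.List.Properties using (++-conicalʳ)
open import Data.List.Relation.Unary.All as All using (All; []; _∷_)
open import Data.List.Relation.Unary.Any as Any using (Any; here; there)
open import Data.Nat using (ℕ; _≤_; _<_; _+_; _*_; _<ᵇ_; z≤n)
open import Data.Nat.Properties
  using (≤-refl; ≤-reflexive; ≤-trans; +-mono-≤; m≤m+n; m≤n+m; *-distribˡ-+; *-identityʳ; *-zeroʳ;
         <⇒<ᵇ; <-cmp; +-commutativeSemigroup; module ≤-Reasoning)
open import Data.Product using (_×_; _,_; proj₁; ∃-syntax)
open import Function using (_∘_; case_of_)
open import Function.Bundles using (Equivalence)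
open import Relation.Binary using (tri<; tri≈; tri>)
open import Relation.Binary.PropositionalEquality using (_≡_; _≢_; refl; sym; trans; cong; cong₂)
open import Relation.Nullary using (Dec; yes; no; ¬_)
open import Relation.Nullary.Decidable using (⌊_⌋; isYes≗does; dec-true; dec-false)

sumBy : ∀ {A : Set} → (A → ℕ) → List A → ℕ
sumBy f []       = 0
sumBy f (x ∷ xs) = f x + sumBy f xs

sumBy-+ : ∀ {A : Set} (f g : A → ℕ) xs → sumBy (λ x → f x + g x) xs ≡ sumBy f xs + sumBy g xs
sumBy-+ f g []       = refl
sumBy-+ f g (x ∷ xs) = trans (cong (f x + g x +_) (sumBy-+ f g xs))
                             (interchange +-commutativeSemigroup (f x) (g x) (sumBy f xs) (sumBy g xs))

Any-≤⇒≤sumBy : ∀ {A : Set} {f : A → ℕ} {k xs} → Any (λ x → k ≤ f x) xs → k ≤ sumBy f xs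
Any-≤⇒≤sumBy {f = f} {xs = x ∷ xs} (here k≤fx) = ≤-trans k≤fx (m≤m+n (f x) _)
Any-≤⇒≤sumBy {f = f} {xs = x ∷ xs} (there k≤) = ≤-trans (Any-≤⇒≤sumBy k≤) (m≤n+m _ (f x))

count-≤-sumBy-count : ∀ {A B : Set} (f : A → Bool) (g : B → A → Bool) (es : List B) {xs} →
  All (λ x → f x ≡ true → Any (λ e → g e x ≡ true) es) xs →
  count f xs ≤ sumBy (λ e → count (g e) xs) es
count-≤-sumBy-count f g es []                          = z≤n
count-≤-sumBy-count f g es {x ∷ xs} (covered ∷ coveredAll) = begin
  (if f x then 1 else 0) + count f xs
    ≤⟨ +-mono-≤ (hit (f x) covered) (count-≤-sumBy-count f g es coveredAll) ⟩
  sumBy (λ e → if g e x then 1 else 0) es + sumBy (λ e → count (g e) xs) es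
    ≡⟨ sumBy-+ (λ e → if g e x then 1 else 0) (λ e → count (g e) xs) es ⟨
  sumBy (λ e → count (g e) (x ∷ xs)) es ∎
  where
  open ≤-Reasoning
  hit : (b : Bool) → (b ≡ true → Any (λ e → g e x ≡ true) es) →
        (if b then 1 else 0) ≤ sumBy (λ e → if g e x then 1 else 0) es
  hit false _       = z≤n
  hit true  covered = Any-≤⇒≤sumBy (Any.map one≤ (covered refl))
    where
    one≤ : ∀ {b} → b ≡ true → 1 ≤ (if b then 1 else 0)
    one≤ refl = ≤-refl

sumBy-≤-*count : ∀ {A : Set} (p : A → Bool) (h : A → ℕ) α →
  (∀ x → h x ≤ (if p x then α else 0)) → ∀ xs → sumBy h xs ≤ α * count p xs
sumBy-≤-*count p h α h≤ []       = z≤n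
sumBy-≤-*count p h α h≤ (x ∷ xs) = begin
  h x + sumBy h xs                              ≤⟨ +-mono-≤ (h≤ x) (sumBy-≤-*count p h α h≤ xs) ⟩
  (if p x then α else 0) + α * count p xs       ≡⟨ cong (_+ α * count p xs) (scale (p x)) ⟨
  α * (if p x then 1 else 0) + α * count p xs   ≡⟨ *-distribˡ-+ α _ (count p xs) ⟨
  α * count p (x ∷ xs)                          ∎
  where
  open ≤-Reasoning
  scale : ∀ b → α * (if b then 1 else 0) ≡ (if b then α else 0)
  scale true  = *-identityʳ α
  scale false = *-zeroʳ α

count-false : ∀ {A : Set} (xs : List A) → count (λ _ → false) xs ≡ 0
count-false []       = refl
count-false (_ ∷ xs) = count-false xs

count-∧ˡ-≤ : ∀ {A : Set} b (f : A → Bool) xs {k} → (b ≡ true → count f xs ≤ k) →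
  count (λ x → b ∧ f x) xs ≤ (if b then k else 0)
count-∧ˡ-≤ true  f xs count≤k = count≤k refl
count-∧ˡ-≤ false f xs _       = ≤-reflexive (count-false xs)

⌊⌋≡true : ∀ {A : Set} (a? : Dec A) → A → ⌊ a? ⌋ ≡ true
⌊⌋≡true a? a = trans (isYes≗does a?) (dec-true a? a)

⌊⌋≡false : ∀ {A : Set} (a? : Dec A) → ¬ A → ⌊ a? ⌋ ≡ false
⌊⌋≡false a? ¬a = trans (isYes≗does a?) (dec-false a? ¬a)

sameEdge-refl : ∀ {n} (a b : Fin n) → sameEdge a b a b ≡ true
sameEdge-refl a b rewrite ⌊⌋≡true (a Fin.≟ a) refl | ⌊⌋≡true (b Fin.≟ b) refl = refl

usesEdge-comm : ∀ {n} (a b r : Fin n) p → usesEdge a b r p ≡ usesEdge b a r p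
usesEdge-comm a b r []       = refl
usesEdge-comm a b r (x ∷ xs) =
  cong₂ Bool._∨_ (∨-comm (⌊ r Fin.≟ a ⌋ ∧ ⌊ x Fin.≟ b ⌋) (⌊ r Fin.≟ b ⌋ ∧ ⌊ x Fin.≟ a ⌋))
                 (usesEdge-comm a b x xs)

allPairs : ∀ n → List (Fin n × Fin n)
allPairs n = concatMap (λ u → map (λ v → (u , v)) (allFin n)) (allFin n)

∈-allPairs : ∀ {n} (u v : Fin n) → (u , v) ∈ allPairs n
∈-allPairs {n} u v = ∈-concatMap⁺ (λ u → map (λ v → (u , v)) (allFin n))
                       (Any.map (λ { refl → ∈-map⁺ (u ,_) (∈-allFin v) }) (∈-allFin u))

module _ {n} (G : Graph n) (ℓ : Labeling n) where

  walk-crosses-cut : ∀ {r} p → IsWalk G r p → ℓ (endpoint r p) ≢ ℓ r →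
    ∃[ u ] ∃[ v ] (adj G u v ≡ true × ℓ u ≢ ℓ v × usesEdge u v r p ≡ true)
  walk-crosses-cut []       _           ℓr≢ℓr = ⊥-elim (ℓr≢ℓr refl)
  walk-crosses-cut {r} (x ∷ xs) (rx , walk) ℓend≢ℓr with ℓ x Bool.≟ ℓ r
  ... | no ℓx≢ℓr =
    r , x , rx , ℓx≢ℓr ∘ sym , cong (Bool._∨ usesEdge r x x xs) (sameEdge-refl r x)
  ... | yes ℓx≡ℓr with walk-crosses-cut xs walk (λ ℓend≡ℓx → ℓend≢ℓr (trans ℓend≡ℓx ℓx≡ℓr))
  ...   | u , v , uv , ℓu≢ℓv , uses =
    u , v , uv , ℓu≢ℓv , trans (cong (sameEdge u v r x Bool.∨_) uses) (∨-zeroʳ _)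

  -- `cutSize G ℓ` and `mistakes A ℓ qs` unfold to counts of `isCutPair` over
  -- `allPairs n` and of `isMistake` over `run A qs`.
  isCutPair : Fin n × Fin n → Bool
  isCutPair (u , v) = (toℕ u <ᵇ toℕ v) ∧ adj G u v ∧ not ⌊ ℓ u Bool.≟ ℓ v ⌋

  crossesCut : Fin n × Fin n → Fin n × List (Fin n) → Bool
  crossesCut (u , v) (r , p) = isCutPair (u , v) ∧ usesEdge u v r p

  isMistake : Fin n × List (Fin n) → Bool
  isMistake (r , p) = not ⌊ ℓ (endpoint r p) Bool.≟ ℓ r ⌋

  isCutPair-adj : ∀ {u v} → isCutPair (u , v) ≡ true → adj G u v ≡ true
  isCutPair-adj {u} {v} cut with toℕ u <ᵇ toℕ v | adj G u v
  isCutPair-adj () | false | _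
  isCutPair-adj () | true  | false
  ... | true | true = refl

  isCutPair-intro : ∀ {u v} → toℕ u < toℕ v → adj G u v ≡ true → ℓ u ≢ ℓ v → isCutPair (u , v) ≡ true
  isCutPair-intro {u} {v} u<v uv ℓu≢ℓv
    rewrite Equivalence.to T-≡ (<⇒<ᵇ u<v) | uv | ⌊⌋≡false (ℓ u Bool.≟ ℓ v) ℓu≢ℓv = refl

  adj⇒≢ : ∀ {u v} → adj G u v ≡ true → u ≢ v
  adj⇒≢ {u} uv refl = case trans (sym uv) (irref G u) of λ ()

  crossing-edge-is-cut-pair : ∀ {u v} r p →
    adj G u v ≡ true → ℓ u ≢ ℓ v → usesEdge u v r p ≡ true →
    Any (λ e → crossesCut e (r , p) ≡ true) (allPairs n)
  crossing-edge-is-cut-pair {u} {v} r p uv ℓu≢ℓv uses with <-cmp (toℕ u) (toℕ v)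
  ... | tri< u<v _ _ = lose (∈-allPairs u v) (cong₂ _∧_ (isCutPair-intro u<v uv ℓu≢ℓv) uses)
  ... | tri≈ _ u≡v _ = ⊥-elim (adj⇒≢ uv (toℕ-injective u≡v))
  ... | tri> _ _ v<u = lose (∈-allPairs v u) (cong₂ _∧_ (isCutPair-intro v<u vu (ℓu≢ℓv ∘ sym)) vu-used)
    where
    vu : adj G v u ≡ true
    vu = trans (Graph.sym G v u) uv
    vu-used : usesEdge v u r p ≡ true
    vu-used = trans (usesEdge-comm v u r p) uses

  mistake-crosses-cut : ∀ {r p} → IsWalk G r p → isMistake (r , p) ≡ true →
    Any (λ e → crossesCut e (r , p) ≡ true) (allPairs n)
  mistake-crosses-cut {r} {p} walk mistake with ℓ (endpoint r p) Bool.≟ ℓ r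
  mistake-crosses-cut {r} {p} walk () | yes _
  ... | no ℓend≢ℓr with walk-crosses-cut p walk ℓend≢ℓr
  ...   | u , v , uv , ℓu≢ℓv , uses = crossing-edge-is-cut-pair r p uv ℓu≢ℓv uses

runFrom-walks : ∀ {n} {G : Graph n} (A : RoutingAlgorithm G) prev rs → prev ≢ [] →
  All (λ { (r , p) → IsWalk G r p }) (runFrom A prev rs)
runFrom-walks A prev []       prev≢[] = []
runFrom-walks A prev (r ∷ rs) prev≢[] =
  proj₁ (valid A prev r prev≢[]) ∷
  runFrom-walks A (prev ++ r ∷ []) rs (λ eq → case ++-conicalʳ prev _ eq of λ ())

run-walks : ∀ {n} {G : Graph n} (A : RoutingAlgorithm G) qs →
  All (λ { (r , p) → IsWalk G r p }) (run A qs)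
run-walks A []       = []
run-walks A (q ∷ qs) = runFrom-walks A (q ∷ []) qs (λ ())

theorem1 : ∀ {n : ℕ} (G : Graph n) → Connected G → (ℓ : Labeling n) →
    (α : ℕ) (A : RoutingAlgorithm G) →
    (∀ (rs : List (Fin n)) (a b : Fin n) → adj G a b ≡ true → congestion A rs a b ≤ α) →
    ∀ (qs : List (Fin n)) → mistakes A ℓ qs ≤ α * cutSize G ℓ
theorem1 {n} G _ ℓ α A congestion≤α qs = begin
  count (isMistake G ℓ) (run A qs)
    ≤⟨ count-≤-sumBy-count (isMistake G ℓ) (crossesCut G ℓ) (allPairs n)
         (All.map (mistake-crosses-cut G ℓ) (run-walks A qs)) ⟩
  sumBy (λ e → count (crossesCut G ℓ e) (run A qs)) (allPairs n)
    ≤⟨ sumBy-≤-*count (isCutPair G ℓ) _ α load≤ (allPairs n) ⟩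
  α * count (isCutPair G ℓ) (allPairs n) ∎
  where
  open ≤-Reasoning
  load≤ : ∀ e → count (crossesCut G ℓ e) (run A qs) ≤ (if isCutPair G ℓ e then α else 0)
  load≤ (u , v) = count-∧ˡ-≤ (isCutPair G ℓ (u , v)) (λ { (r , p) → usesEdge u v r p }) (run A qs)
                    (λ cut → congestion≤α qs u v (isCutPair-adj G ℓ cut))
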